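{- Every Chip Firing Game $CFG(G,\mathcal{O})$ whose support graph $G$ is a directed acyclic multigraph is equivalent to an Abelian Sandpile Model, i.e. there is an ASM whose generated lattice is isomorphic to the lattice $CFG(G,\mathcal{O})$.
   Context: Chip Firing Games: $G$ a finite directed multigraph, $E(u,v)$ the number of edges from $u$ to $v$, $deg^{+}(v)=\sum_uE(v,u)$; a sink is a vertex all of whose outgoing edges are loops. A configuration is a map $c:V(G)\to\mathbb{N}$; a non-sink $v$ is firable in $c$ if $c(v)\ge deg^{+}(v)$, and firing $v$ moves one chip from $v$ along each outgoing edge. Given an initial configuration $\mathcal{O}$, $CFG(G,\mathcal{O})$ is the set of configurations reachable from $\mathcal{O}$ by firings, ordered by $c_1\le c_2$ iff $c_2$ is reachable from $c_1$; when no infinite sequence of firings exists (always the case if $G$ is acyclic) this is a lattice, the lattice generated by the game. Two games are equivalent if their generated lattices are isomorphic. An acyclic graph is a directed graph with no directed cycle. An Abelian Sandpile Model (ASM) is a game $CFG(G,\mathcal{O})$ in which $G$ is connected, has exactly one sink $s$, and $E(v_1,v_2)=E(v_2,v_1)$ for all distinct $v_1,v_2\neq s$. -}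

module Defs where

open import Data.Nat using (ℕ; _≤_; _<_; _∸_; _+_)
open import Data.Fin using (Fin; _≟_)
open import Data.Vec using (Vec; tabulate; lookup; sum)
open import Data.Product using (Σ; ∃; _×_; proj₁)
open import Data.Sum using (_⊎_)
open import Relation.Nullary using (¬_; yes; no)
open import Relation.Binary.PropositionalEquality using (_≡_; _≢_)
open import Relation.Binary.Construct.Closure.ReflexiveTransitive using (Star)
open import Relation.Binary.Construct.Closure.Transitive using (TransClosure)

-- A finite directed multigraph on vertex set Fin n:
-- E u v = number of edges from u to v (loops allowed).
Graph : ℕ → Set
Graph n = Fin n → Fin n → ℕ

Config : ℕ → Set
Config n = Vec ℕ n

module _ {n : ℕ} (G : Graph n) where

  deg⁺ : Fin n → ℕ
  deg⁺ v = sum (tabulate (G v))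

  IsSink : Fin n → Set
  IsSink v = ∀ u → u ≢ v → G v u ≡ 0

  fire : Config n → Fin n → Config n
  fire c v = tabulate λ w → (base w) + G v w
    where
    base : Fin n → ℕ
    base w with w ≟ v
    ... | yes _ = lookup c w ∸ deg⁺ v
    ... | no _  = lookup c w

  Step : Config n → Config n → Set
  Step c c' = ∃ λ v → ¬ IsSink v × deg⁺ v ≤ lookup c v × c' ≡ fire c v

  -- reachability (reflexive-transitive closure of Step); this is the order of CFG(G,O)
  Reach : Config n → Config n → Set
  Reach = Star Step

  CFG : Config n → Set
  CFG O = Σ (Config n) (Reach O)

  Adj : Fin n → Fin n → Set
  Adj u v = 0 < G u v

  Acyclic : Set
  Acyclic = ∀ v → ¬ TransClosure Adj v v

  Connected : Set
  Connected = ∀ u v → Star (λ a b → Adj a b ⊎ Adj b a) u v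

  ExactlyOneSink : Set
  ExactlyOneSink = Σ (Fin n) λ s → IsSink s × (∀ v → IsSink v → v ≡ s)

  SymmetricOffSink : Set
  SymmetricOffSink = ∀ v₁ v₂ → v₁ ≢ v₂ → ¬ IsSink v₁ → ¬ IsSink v₂ → G v₁ v₂ ≡ G v₂ v₁

  -- G is the support graph of an Abelian Sandpile Model
  IsASMGraph : Set
  IsASMGraph = Connected × ExactlyOneSink × SymmetricOffSink

-- Isomorphism of the ordered sets (lattices) CFG(G,O) and CFG(H,P)
-- (an order isomorphism between lattices is a lattice isomorphism)
record CFGIso {n m : ℕ} (G : Graph n) (O : Config n) (H : Graph m) (P : Config m) : Set where
  field
    to      : CFG G O → CFG H P
    from    : CFG H P → CFG G O
    from∘to : ∀ x → proj₁ (from (to x)) ≡ proj₁ x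
    to∘from : ∀ y → proj₁ (to (from y)) ≡ proj₁ y
    to-mono   : ∀ x y → Reach G (proj₁ x) (proj₁ y) → Reach H (proj₁ (to x)) (proj₁ (to y))
    from-mono : ∀ x y → Reach H (proj₁ x) (proj₁ y) → Reach G (proj₁ (from x)) (proj₁ (from y))

-- In any game, firing each vertex x exactly f x times from O leads to the
-- configuration config f = O + inflow f - f * deg⁺ (FiringVectors).  When G is acyclic
-- a valid firing vector is determined by its configuration (induction on depth)
-- and is bounded by some N (AcyclicGame).  The sandpile H has a sink and one vertex
-- per slot (v , k), k < N, standing for the (k + 1)-st firing of v; the vector f is
-- mirrored by firing the slots (v , k) with k < f v (Sandpile).  Consecutive slots of v
-- are tied by a heavy chain edge, so a slot can only fire right after its predecessor,
-- and a slot of v receives chips from the fired slots of each u in proportion to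
-- G u v, scaled by M ^ height v.  Heights drop along edges, so the symmetric back-flow
-- stays below one scaled chip, and slot (v , f v) can fire in H exactly when v can
-- fire in G.  Both games are thus faithfully simulated on valid firing vectors, and
-- such a pair of simulations yields the lattice isomorphism (SimulationIso).

module Submission where

open import Defs
open import Data.Bool using (true; false; if_then_else_)
open import Data.Nat using (ℕ; zero; suc; _+_; _*_; _∸_; _^_; _⊔_; _≤_; _<_; z≤n; s≤s; _<?_; >-nonZero; pred)
open import Data.Nat.Properties hiding (_≟_)
open import Data.Nat.Properties using () renaming (_≟_ to _≟ℕ_)
open import Data.Nat.Tactic.RingSolver using (solve-∀)
open import Data.Fin using (Fin; zero; suc; toℕ; _≟_; combine; remQuot; _↑ˡ_; _↑ʳ_; fromℕ<)
open import Data.Fin.Properties using (remQuot-combine; combine-remQuot; toℕ<n; toℕ-injective; toℕ-fromℕ<; pigeonhole)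
open import Data.Vec using (Vec; tabulate; lookup; sum)
open import Data.Vec.Properties using (tabulate-cong; lookup∘tabulate; tabulate∘lookup)
open import Data.Product using (Σ; ∃; _×_; _,_; proj₁; proj₂; uncurry)
open import Data.Sum using (_⊎_; inj₁; inj₂)
open import Data.Empty using (⊥-elim)
open import Function using (_∘_; id)
open import Relation.Nullary using (¬_; Dec; does; yes; no)
open import Relation.Nullary.Decidable using (dec-true; dec-false; toSum)
open import Relation.Binary.Definitions using (tri<; tri≈; tri>)
open import Relation.Binary.PropositionalEquality
open import Relation.Binary.Construct.Closure.Transitive using (TransClosure; [_]; _∷_; _∷ʳ_)
open import Relation.Binary.Construct.Closure.ReflexiveTransitive using (Star; ε; _◅_; _◅◅_)

-- Finite sums over Fin n.  deg⁺ K v is definitionally ∑ (K v).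
∑ : ∀ {n} → (Fin n → ℕ) → ℕ
∑ f = sum (tabulate f)

∑-cong : ∀ {n} {f g : Fin n → ℕ} → (∀ i → f i ≡ g i) → ∑ f ≡ ∑ g
∑-cong f≗g = cong sum (tabulate-cong f≗g)

∑-zero : ∀ {n} {f : Fin n → ℕ} → (∀ i → f i ≡ 0) → ∑ f ≡ 0
∑-zero {zero}  f≗0 = refl
∑-zero {suc n} f≗0 rewrite f≗0 zero = ∑-zero (f≗0 ∘ suc)

∑-+ : ∀ {n} (f g : Fin n → ℕ) → ∑ (λ i → f i + g i) ≡ ∑ f + ∑ g
∑-+ {zero}  f g = refl
∑-+ {suc n} f g rewrite ∑-+ (f ∘ suc) (g ∘ suc) = interchange (f zero) (g zero) _ _
  where
  interchange : ∀ a b c d → (a + b) + (c + d) ≡ (a + c) + (b + d)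
  interchange = solve-∀

∑-+₄ : ∀ {n} (a b c e : Fin n → ℕ) → ∑ (λ j → a j + b j + c j + e j) ≡ ∑ a + ∑ b + ∑ c + ∑ e
∑-+₄ a b c e = trans (∑-+ (λ j → a j + b j + c j) e)
  (cong (_+ ∑ e) (trans (∑-+ (λ j → a j + b j) c) (cong (_+ ∑ c) (∑-+ a b))))

∑-*ˡ : ∀ {n} c (f : Fin n → ℕ) → ∑ (λ i → c * f i) ≡ c * ∑ f
∑-*ˡ {zero}  c f = sym (*-zeroʳ c)
∑-*ˡ {suc n} c f rewrite ∑-*ˡ c (f ∘ suc) = sym (*-distribˡ-+ c (f zero) (∑ (f ∘ suc)))

∑-*ʳ : ∀ {n} (f : Fin n → ℕ) c → ∑ (λ i → f i * c) ≡ ∑ f * c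
∑-*ʳ f c = trans (∑-cong (λ i → *-comm (f i) c)) (trans (∑-*ˡ c f) (*-comm c (∑ f)))

∑-const : ∀ {n} c → ∑ {n} (λ _ → c) ≡ n * c
∑-const {zero}  c = refl
∑-const {suc n} c = cong (c +_) (∑-const {n} c)

∑-mono-≤ : ∀ {n} {f g : Fin n → ℕ} → (∀ i → f i ≤ g i) → ∑ f ≤ ∑ g
∑-mono-≤ {zero}  f≤g = z≤n
∑-mono-≤ {suc n} f≤g = +-mono-≤ (f≤g zero) (∑-mono-≤ (f≤g ∘ suc))

term≤∑ : ∀ {n} (f : Fin n → ℕ) i → f i ≤ ∑ f
term≤∑ f zero    = m≤m+n _ _
term≤∑ f (suc i) = ≤-trans (term≤∑ (f ∘ suc) i) (m≤n+m _ _)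

∑≡0⇒term≡0 : ∀ {n} (f : Fin n → ℕ) → ∑ f ≡ 0 → ∀ i → f i ≡ 0
∑≡0⇒term≡0 f ∑≡0 i = n≤0⇒n≡0 (subst (f i ≤_) ∑≡0 (term≤∑ f i))

∑-↑ : ∀ a b (h : Fin (a + b) → ℕ) → ∑ h ≡ ∑ (λ i → h (i ↑ˡ b)) + ∑ (λ j → h (a ↑ʳ j))
∑-↑ zero    b h = refl
∑-↑ (suc a) b h rewrite ∑-↑ a b (h ∘ suc) =
  sym (+-assoc (h zero) (∑ {a} (λ i → h (suc (i ↑ˡ b)))) (∑ {b} (λ j → h (suc a ↑ʳ j))))

∑-combine : ∀ m n (h : Fin (m * n) → ℕ) → ∑ h ≡ ∑ {m} (λ i → ∑ {n} (λ k → h (combine i k)))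
∑-combine zero    n h = refl
∑-combine (suc m) n h rewrite ∑-↑ n (m * n) h =
  cong (∑ (λ k → h (k ↑ˡ (m * n))) +_) (∑-combine m n (λ j → h (n ↑ʳ j)))

∑-remQuot : ∀ m n (g : Fin m × Fin n → ℕ) →
            ∑ (λ j → g (remQuot {m} n j)) ≡ ∑ {m} (λ i → ∑ {n} (λ k → g (i , k)))
∑-remQuot m n g = trans (∑-combine m n _) (∑-cong λ i → ∑-cong λ k → cong g (remQuot-combine i k))

𝟙 : ∀ {a} {A : Set a} → Dec A → ℕ
𝟙 a? = if does a? then 1 else 0

module _ {a} {A : Set a} (a? : Dec A) where

  𝟙-yes : A → 𝟙 a? ≡ 1
  𝟙-yes x rewrite dec-true a? x = refl

  𝟙-no : ¬ A → 𝟙 a? ≡ 0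
  𝟙-no ¬x rewrite dec-false a? ¬x = refl

  𝟙-*≤ : ∀ t → 𝟙 a? * t ≤ t
  𝟙-*≤ t with does a?
  ... | true  = ≤-reflexive (+-identityʳ t)
  ... | false = z≤n

∑-δ : ∀ {n} (v : Fin n) (g : Fin n → ℕ) → ∑ (λ y → 𝟙 (y ≟ v) * g y) ≡ g v
∑-δ {suc n} zero    g = trans (cong₂ _+_ (+-identityʳ (g zero)) (∑-zero {n} (λ _ → refl))) (+-identityʳ _)
∑-δ {suc n} (suc v) g = ∑-δ v (g ∘ suc)

∑-count-below : ∀ N a → a ≤ N → ∑ {N} (λ m → 𝟙 (toℕ m <? a)) ≡ a
∑-count-below zero    zero    _       = refl
∑-count-below (suc N) zero    _       = ∑-zero {N} (λ _ → refl)
∑-count-below (suc N) (suc a) (s≤s p) = cong suc (∑-count-below N a p)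

𝟙-<-suc : ∀ {a b} → a ≢ b → 𝟙 (a <? suc b) ≡ 𝟙 (a <? b)
𝟙-<-suc {a} {b} a≢b with <-cmp a b
... | tri< a<b _ _ = trans (𝟙-yes (a <? suc b) (m<n⇒m<1+n a<b)) (sym (𝟙-yes (a <? b) a<b))
... | tri≈ _ a≡b _ = ⊥-elim (a≢b a≡b)
... | tri> _ _ a>b = trans (𝟙-no (a <? suc b) (≤⇒≯ a>b)) (sym (𝟙-no (a <? b) (<⇒≯ a>b)))

vec-ext : ∀ {a} {A : Set a} {n} {xs ys : Vec A n} → (∀ i → lookup xs i ≡ lookup ys i) → xs ≡ ys
vec-ext {xs = xs} {ys} xs≗ys = trans (sym (tabulate∘lookup xs)) (trans (tabulate-cong xs≗ys) (tabulate∘lookup ys))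

lookup-tabulate : ∀ {n} {F : Fin n → ℕ} {x} w → F w ≡ x → lookup (tabulate F) w ≡ x
lookup-tabulate w Fw≡x = trans (lookup∘tabulate _ w) Fw≡x

module _ {n : ℕ} (K : Graph n) where

  fireEntry : Config n → Fin n → Fin n → ℕ
  fireEntry c v w with w ≟ v
  ... | yes _ = lookup c w ∸ deg⁺ K v + K v w
  ... | no _  = lookup c w + K v w

  -- Defs.fire performs its case split inside an anonymous where-clause, so the
  -- unfolded entry cannot be written down here; fire-entry's left-hand side is
  -- inferred from its single use in fire-lookup.
  mutual
    fire-lookup : ∀ c v w → lookup (fire K c v) w ≡ fireEntry c v w
    fire-lookup c v w = lookup-tabulate w (fire-entry c v w)

    fire-entry : ∀ c v w → _ ≡ fireEntry c v w
    fire-entry c v w with w ≟ v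
    ... | yes _ = refl
    ... | no _  = refl

  fire-lookup-self : ∀ c v → lookup (fire K c v) v ≡ lookup c v ∸ deg⁺ K v + K v v
  fire-lookup-self c v with v ≟ v | fire-lookup c v v
  ... | yes _  | e = e
  ... | no v≢v | _ = ⊥-elim (v≢v refl)

  fire-lookup-other : ∀ c v w → w ≢ v → lookup (fire K c v) w ≡ lookup c w + K v w
  fire-lookup-other c v w w≢v with w ≟ v | fire-lookup c v w
  ... | yes w≡v | _ = ⊥-elim (w≢v w≡v)
  ... | no _    | e = e

module FiringVectors {n : ℕ} (K : Graph n) (Q : Config n) where

  d : Fin n → ℕ
  d = deg⁺ K

  inflow : (Fin n → ℕ) → Fin n → ℕ
  inflow f x = ∑ (λ y → f y * K y x)

  supply : (Fin n → ℕ) → Fin n → ℕ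
  supply f x = lookup Q x + inflow f x

  Admissible : (Fin n → ℕ) → Set
  Admissible f = ∀ x → f x * d x ≤ supply f x

  config : (Fin n → ℕ) → Config n
  config f = tabulate (λ x → supply f x ∸ f x * d x)

  CanFire : (Fin n → ℕ) → Fin n → Set
  CanFire f v = suc (f v) * d v ≤ supply f v

  _⊕_ : (Fin n → ℕ) → Fin n → Fin n → ℕ
  (f ⊕ v) y = f y + 𝟙 (y ≟ v)

  config-lookup : ∀ f x → lookup (config f) x ≡ supply f x ∸ f x * d x
  config-lookup f x = lookup∘tabulate _ x

  config-balance : ∀ f → Admissible f → ∀ x → lookup (config f) x + f x * d x ≡ supply f x
  config-balance f adm x rewrite config-lookup f x = m∸n+n≡m (adm x)

  inflow-cong : ∀ {f g} → (∀ y → f y ≡ g y) → ∀ x → inflow f x ≡ inflow g x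
  inflow-cong f≗g x = ∑-cong (λ y → cong (_* K y x) (f≗g y))

  config-cong : ∀ {f g} → (∀ y → f y ≡ g y) → config f ≡ config g
  config-cong f≗g = tabulate-cong λ x →
    cong₂ (λ a b → (lookup Q x + a) ∸ b * d x) (inflow-cong f≗g x) (f≗g x)

  config-zero : config (λ _ → 0) ≡ Q
  config-zero = vec-ext λ x → trans (config-lookup (λ _ → 0) x)
    (trans (cong (lookup Q x +_) (∑-zero {n} {λ y → 0 * K y x} (λ _ → refl))) (+-identityʳ _))

  ⊕-self : ∀ f v → (f ⊕ v) v ≡ suc (f v)
  ⊕-self f v rewrite 𝟙-yes (v ≟ v) refl = +-comm (f v) 1

  ⊕-other : ∀ f {v w} → w ≢ v → (f ⊕ v) w ≡ f w
  ⊕-other f {v} {w} w≢v rewrite 𝟙-no (w ≟ v) w≢v = +-identityʳ (f w)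

  inflow-⊕ : ∀ f v x → inflow (f ⊕ v) x ≡ inflow f x + K v x
  inflow-⊕ f v x = begin
    ∑ (λ y → (f y + 𝟙 (y ≟ v)) * K y x)                  ≡⟨ ∑-cong (λ y → *-distribʳ-+ (K y x) (f y) _) ⟩
    ∑ (λ y → f y * K y x + 𝟙 (y ≟ v) * K y x)            ≡⟨ ∑-+ (λ y → f y * K y x) _ ⟩
    inflow f x + ∑ (λ y → 𝟙 (y ≟ v) * K y x)             ≡⟨ cong (inflow f x +_) (∑-δ v (λ y → K y x)) ⟩
    inflow f x + K v x                                    ∎
    where open ≡-Reasoning

  supply-⊕ : ∀ f v x → supply (f ⊕ v) x ≡ supply f x + K v x
  supply-⊕ f v x = trans (cong (lookup Q x +_) (inflow-⊕ f v x)) (sym (+-assoc (lookup Q x) _ _))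

  inflow-local : ∀ f g v → (∀ w → Adj K w v → f w ≡ g w) → inflow f v ≡ inflow g v
  inflow-local f g v agree = ∑-cong term
    where
    term : ∀ w → f w * K w v ≡ g w * K w v
    term w with 0 <? K w v
    ... | yes wv  = cong (_* K w v) (agree w wv)
    ... | no ¬wv rewrite n≤0⇒n≡0 (≮⇒≥ ¬wv) = trans (*-zeroʳ (f w)) (sym (*-zeroʳ (g w)))

  total-edges : ℕ
  total-edges = ∑ (λ w → ∑ (K w))

  inflow-bound : ∀ f b v → (∀ w → Adj K w v → f w ≤ b) → inflow f v ≤ b * total-edges
  inflow-bound f b v bounded = begin
    ∑ (λ w → f w * K w v)   ≤⟨ ∑-mono-≤ term ⟩
    ∑ (λ w → b * K w v)     ≡⟨ ∑-*ˡ b (λ w → K w v) ⟩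
    b * ∑ (λ w → K w v)     ≤⟨ *-monoʳ-≤ b (∑-mono-≤ (λ w → term≤∑ (K w) v)) ⟩
    b * total-edges         ∎
    where
    open ≤-Reasoning
    term : ∀ w → f w * K w v ≤ b * K w v
    term w with 0 <? K w v
    ... | yes wv  = *-monoˡ-≤ (K w v) (bounded w wv)
    ... | no ¬wv rewrite n≤0⇒n≡0 (≮⇒≥ ¬wv) | *-zeroʳ (f w) = z≤n

  firable⇒CanFire : ∀ f → Admissible f → ∀ v → d v ≤ lookup (config f) v → CanFire f v
  firable⇒CanFire f adm v le =
    subst (d v + f v * d v ≤_) (config-balance f adm v) (+-monoˡ-≤ (f v * d v) le)

  CanFire⇒firable : ∀ f → Admissible f → ∀ v → CanFire f v → d v ≤ lookup (config f) v
  CanFire⇒firable f adm v can =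
    +-cancelʳ-≤ (f v * d v) _ _ (subst (d v + f v * d v ≤_) (sym (config-balance f adm v)) can)

  Admissible-⊕ : ∀ f v → Admissible f → CanFire f v → Admissible (f ⊕ v)
  Admissible-⊕ f v adm can x with toSum (x ≟ v)
  ... | inj₁ refl rewrite ⊕-self f v | supply-⊕ f v v = ≤-trans can (m≤m+n _ _)
  ... | inj₂ x≢v rewrite ⊕-other f x≢v | supply-⊕ f v x = ≤-trans (adm x) (m≤m+n _ _)

  fire-config : ∀ f v → Admissible f → CanFire f v → fire K (config f) v ≡ config (f ⊕ v)
  fire-config f v adm can = vec-ext entry
    where
    open ≡-Reasoning
    entry : ∀ w → lookup (fire K (config f) v) w ≡ lookup (config (f ⊕ v)) w
    entry w with toSum (w ≟ v)
    ... | inj₁ refl = begin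
      lookup (fire K (config f) v) v              ≡⟨ fire-lookup-self K (config f) v ⟩
      lookup (config f) v ∸ d v + K v v            ≡⟨ cong (λ a → a ∸ d v + K v v) (config-lookup f v) ⟩
      supply f v ∸ f v * d v ∸ d v + K v v         ≡⟨ cong (_+ K v v) (∸-+-assoc (supply f v) (f v * d v) (d v)) ⟩
      supply f v ∸ (f v * d v + d v) + K v v       ≡⟨ cong (λ a → supply f v ∸ a + K v v) (+-comm (f v * d v) (d v)) ⟩
      supply f v ∸ suc (f v) * d v + K v v         ≡⟨ sym (+-∸-comm (K v v) can) ⟩
      (supply f v + K v v) ∸ suc (f v) * d v       ≡⟨ cong₂ (λ a b → a ∸ b * d v) (sym (supply-⊕ f v v)) (sym (⊕-self f v)) ⟩
      supply (f ⊕ v) v ∸ (f ⊕ v) v * d v           ≡⟨ sym (config-lookup (f ⊕ v) v) ⟩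
      lookup (config (f ⊕ v)) v                    ∎
    ... | inj₂ w≢v = begin
      lookup (fire K (config f) v) w              ≡⟨ fire-lookup-other K (config f) v w w≢v ⟩
      lookup (config f) w + K v w                  ≡⟨ cong (_+ K v w) (config-lookup f w) ⟩
      supply f w ∸ f w * d w + K v w               ≡⟨ sym (+-∸-comm (K v w) (adm w)) ⟩
      (supply f w + K v w) ∸ f w * d w             ≡⟨ cong₂ (λ a b → a ∸ b * d w) (sym (supply-⊕ f v w)) (sym (⊕-other f w≢v)) ⟩
      supply (f ⊕ v) w ∸ (f ⊕ v) w * d w           ≡⟨ sym (config-lookup (f ⊕ v) w) ⟩
      lookup (config (f ⊕ v)) w                    ∎

maxF : ∀ {m} → (Fin m → ℕ) → ℕ
maxF {zero}  g = 0
maxF {suc m} g = g zero ⊔ maxF (g ∘ suc)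

maxF-ub : ∀ {m} (g : Fin m → ℕ) i → g i ≤ maxF g
maxF-ub g zero    = m≤m⊔n _ _
maxF-ub g (suc i) = ≤-trans (maxF-ub (g ∘ suc) i) (m≤n⊔m _ _)

maxF-attained : ∀ {m} (g : Fin m → ℕ) → 0 < maxF g → ∃ λ i → maxF g ≡ g i
maxF-attained {suc m} g pos with ⊔-sel (g zero) (maxF (g ∘ suc))
... | inj₁ e = zero , e
... | inj₂ e with maxF-attained (g ∘ suc) (subst (0 <_) e pos)
...   | i , e' = suc i , trans e e'

module Height {n : ℕ} (K : Graph n) (acyclic : Acyclic K) where

  -- A walk of length x from u, prolonged backwards by an edge u → v, if there is one.
  extend : ∀ {u v} → Dec (Adj K u v) → ℕ → ℕ
  extend (yes _) x = suc x
  extend (no _)  _ = 0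

  -- longest k v is the length of the longest walk of length at most k starting at v.
  longest : ℕ → Fin n → ℕ
  longest zero    v = 0
  longest (suc k) v = maxF (λ u → extend (0 <? K v u) (longest k u))

  longest-edge : ∀ k {v u} → Adj K v u → suc (longest k u) ≤ longest (suc k) v
  longest-edge k {v} {u} vu with maxF-ub (λ u → extend (0 <? K v u) (longest k u)) u
  ... | ub with 0 <? K v u
  ...   | yes _ = ub
  ...   | no ¬vu = ⊥-elim (¬vu vu)

  longest-witness : ∀ k v → 0 < longest (suc k) v → ∃ λ u → Adj K v u × longest (suc k) v ≡ suc (longest k u)
  longest-witness k v pos with maxF-attained (λ u → extend (0 <? K v u) (longest k u)) pos
  ... | u , e with 0 <? K v u
  ...   | yes vu = u , vu , e
  ...   | no _   = ⊥-elim (<-irrefl (sym e) pos)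

  longest-grows : ∀ k v → longest k v < longest (suc k) v → k < longest (suc k) v
  longest-grows zero    v lt = lt
  longest-grows (suc k) v lt with longest-witness (suc k) v (≤-trans (s≤s z≤n) lt)
  ... | u , vu , e = subst (suc k <_) (sym e) (s≤s (longest-grows k u u-grows))
    where
    u-grows : longest k u < longest (suc k) u
    u-grows = ≤-pred (≤-trans (s≤s (longest-edge k vu)) (subst (longest (suc k) v <_) e lt))

  Walk : ℕ → Fin n → Set
  Walk j v = Σ (ℕ → Fin n) λ w → w 0 ≡ v × (∀ i → i < j → Adj K (w i) (w (suc i)))

  walk : ∀ k v j → j ≤ longest k v → Walk j v
  walk k       v zero    _ = (λ _ → v) , refl , (λ _ ())
  walk (suc k) v (suc j) le with longest-witness k v (≤-trans (s≤s z≤n) le)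
  ... | u , vu , e with walk k u j (≤-pred (subst (suc j ≤_) e le))
  ...   | w , w0≡u , steps = v ∷w w , refl , steps'
    where
    _∷w_ : Fin n → (ℕ → Fin n) → ℕ → Fin n
    (x ∷w w) zero    = x
    (x ∷w w) (suc i) = w i
    steps' : ∀ i → i < suc j → Adj K ((v ∷w w) i) ((v ∷w w) (suc i))
    steps' zero    _       = subst (Adj K v) (sym w0≡u) vu
    steps' (suc i) (s≤s p) = steps i p

  walk-path : ∀ {j} (w : ℕ → Fin n) → (∀ i → i < j → Adj K (w i) (w (suc i))) →
              ∀ a b → a < b → b ≤ j → TransClosure (Adj K) (w a) (w b)
  walk-path w steps a (suc b) (s≤s a≤b) b<j with m≤n⇒m<n∨m≡n a≤b
  ... | inj₁ a<b  = walk-path w steps a b a<b (≤-trans (n≤1+n b) b<j) ∷ʳ steps b b<j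
  ... | inj₂ refl = [ steps a b<j ]

  -- By the pigeonhole principle a walk visiting n + 1 vertices revisits one,
  -- producing a directed cycle.
  no-walk-of-length-n : ∀ v → ¬ Walk n v
  no-walk-of-length-n v (w , _ , steps) with pigeonhole (n<1+n n) (λ i → w (toℕ i))
  ... | i , j , i<j , wi≡wj = acyclic (w (toℕ i))
    (subst (TransClosure (Adj K) (w (toℕ i))) (sym wi≡wj) (walk-path w steps (toℕ i) (toℕ j) i<j (≤-pred (toℕ<n j))))

  height : Fin n → ℕ
  height = longest (suc n)

  height-decreases : ∀ {v u} → Adj K v u → height u < height v
  height-decreases {v} {u} vu with longest n u <? longest (suc n) u
  ... | yes grows = ⊥-elim (no-walk-of-length-n u (truncate (walk (suc n) u (suc n) (longest-grows n u grows))))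
    where
    truncate : Walk (suc n) u → Walk n u
    truncate (w , w0 , steps) = w , w0 , (λ i p → steps i (≤-trans p (n≤1+n n)))
  ... | no stable = ≤-trans (s≤s (≮⇒≥ stable)) (longest-edge n vu)

transpose-acyclic : ∀ {n} (K : Graph n) → Acyclic K → Acyclic (λ u v → K v u)
transpose-acyclic K acyclic v cycle = acyclic v (reverse cycle)
  where
  reverse : ∀ {x y} → TransClosure (λ a b → Adj K b a) x y → TransClosure (Adj K) y x
  reverse [ e ]      = [ e ]
  reverse (e ∷ path) = reverse path ∷ʳ e

module Depth {n : ℕ} (K : Graph n) (acyclic : Acyclic K) where
  open Height (λ u v → K v u) (transpose-acyclic K acyclic)
    using () renaming (height to depth; height-decreases to depth-increases) public

  depth-induction : (P : Fin n → Set) → (∀ v → (∀ w → Adj K w v → P w) → P v) → ∀ v → P v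
  depth-induction P step v = go (depth v) v ≤-refl
    where
    go : ∀ k v → depth v ≤ k → P v
    go k v dv≤k = step v λ w wv → go′ k w (<-≤-trans (depth-increases wv) dv≤k)
      where
      go′ : ∀ k w → depth w < k → P w
      go′ (suc k) w lt = go k w (≤-pred lt)

module AcyclicGame {n : ℕ} (G : Graph n) (O : Config n) (acyclic : Acyclic G) where
  open FiringVectors G O public
  open Depth G acyclic public

  Valid : (Fin n → ℕ) → Set
  Valid f = Admissible f × (∀ v → d v ≡ 0 → f v ≡ 0)

  live-or-dead : ∀ v → 0 < d v ⊎ d v ≡ 0
  live-or-dead v with d v ≟ℕ 0
  ... | yes dead  = inj₂ dead
  ... | no ¬dead = inj₁ (n≢0⇒n>0 ¬dead)

  no-loop : ∀ v → G v v ≡ 0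
  no-loop v with 0 <? G v v
  ... | yes loop = ⊥-elim (acyclic v [ loop ])
  ... | no ¬loop = n≤0⇒n≡0 (≮⇒≥ ¬loop)

  live⇒non-sink : ∀ v → 0 < d v → ¬ IsSink G v
  live⇒non-sink v live sink = <-irrefl (sym (∑-zero no-edge)) live
    where
    no-edge : ∀ u → G v u ≡ 0
    no-edge u with toSum (u ≟ v)
    ... | inj₁ refl = no-loop v
    ... | inj₂ u≢v  = sink u u≢v

  non-sink⇒live : ∀ v → ¬ IsSink G v → 0 < d v
  non-sink⇒live v ¬sink with live-or-dead v
  ... | inj₁ live = live
  ... | inj₂ dead = ⊥-elim (¬sink (λ u _ → n≤0⇒n≡0 (subst (G v u ≤_) dead (term≤∑ (G v) u))))

  Valid-zero : Valid (λ _ → 0)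
  Valid-zero = (λ _ → z≤n) , (λ _ _ → refl)

  Valid-⊕ : ∀ f v → Valid f → 0 < d v → CanFire f v → Valid (f ⊕ v)
  Valid-⊕ f v (adm , dead-unfired) live can = Admissible-⊕ f v adm can , dead-unfired′
    where
    dead-unfired′ : ∀ x → d x ≡ 0 → (f ⊕ v) x ≡ 0
    dead-unfired′ x dead with toSum (x ≟ v)
    ... | inj₁ refl = ⊥-elim (<-irrefl (sym dead) live)
    ... | inj₂ x≢v  = trans (⊕-other f x≢v) (dead-unfired x dead)

  fired⇒live : ∀ f → Valid f → ∀ v → 0 < f v → 0 < d v
  fired⇒live f (_ , dead-unfired) v fv>0 with live-or-dead v
  ... | inj₁ live = live
  ... | inj₂ dead = ⊥-elim (<-irrefl (sym (dead-unfired v dead)) fv>0)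

  fired≤supply : ∀ f → Valid f → ∀ v → f v ≤ supply f v
  fired≤supply f (adm , dead-unfired) v with live-or-dead v
  ... | inj₂ dead = subst (_≤ supply f v) (sym (dead-unfired v dead)) z≤n
  ... | inj₁ live = ≤-trans (m≤m*n (f v) (d v) {{>-nonZero live}}) (adm v)

  -- A valid firing vector is determined by its configuration: by depth-induction,
  -- equal inflows at v force equal numbers of firings of v.
  config-injective : ∀ f g → Valid f → Valid g → config f ≡ config g → ∀ v → f v ≡ g v
  config-injective f g (adm-f , dead-f) (adm-g , dead-g) same = depth-induction _ step
    where
    step : ∀ v → (∀ w → Adj G w v → f w ≡ g w) → f v ≡ g v
    step v agree with live-or-dead v
    ... | inj₂ dead = trans (dead-f v dead) (sym (dead-g v dead))
    ... | inj₁ live = *-cancelʳ-≡ (f v) (g v) (d v) {{>-nonZero live}} (+-cancelˡ-≡ (lookup (config f) v) _ _ balance)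
      where
      open ≡-Reasoning
      balance : lookup (config f) v + f v * d v ≡ lookup (config f) v + g v * d v
      balance = begin
        lookup (config f) v + f v * d v   ≡⟨ config-balance f adm-f v ⟩
        lookup O v + inflow f v           ≡⟨ cong (lookup O v +_) (inflow-local f g v agree) ⟩
        lookup O v + inflow g v           ≡⟨ sym (config-balance g adm-g v) ⟩
        lookup (config g) v + g v * d v   ≡⟨ cong (λ c → lookup c v + g v * d v) (sym same) ⟩
        lookup (config f) v + g v * d v   ∎

  total-chips : ℕ
  total-chips = ∑ (lookup O)

  cap : ℕ → ℕ
  cap zero    = 0
  cap (suc k) = total-chips + cap k * total-edges

  -- Induction on depth: f v ≤ O v + inflow f v ≤ total-chips + cap k * total-edges.
  capped : ∀ f → Valid f → ∀ k v → depth v < k → f v ≤ cap k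
  capped f valid (suc k) v (s≤s dv≤k) = ≤-trans (fired≤supply f valid v)
    (+-mono-≤ (term≤∑ (lookup O) v) (inflow-bound f (cap k) v (λ w wv → capped f valid k w (<-≤-trans (depth-increases wv) dv≤k))))

  -- Firing counts of valid vectors are bounded by N; only this bound is ever used.
  opaque
    N : ℕ
    N = suc (cap (suc (∑ depth)))

    firings<N : ∀ f → Valid f → ∀ v → f v < N
    firings<N f valid v = s≤s (capped f valid (suc (∑ depth)) v (s≤s (term≤∑ depth v)))

  firings≤N : ∀ f → Valid f → ∀ v → f v ≤ N
  firings≤N f valid v = <⇒≤ (firings<N f valid v)

module _ {F C D : Set} (Valid : F → Set) (R : C → C → Set) (S : D → D → Set) (φ : F → C) (ψ : F → D)
         (simulate : ∀ f → Valid f → ∀ {c} → R (φ f) c → Σ F λ g → Valid g × c ≡ φ g × S (ψ f) (ψ g)) where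

  simulate⋆ : ∀ f → Valid f → ∀ {c} → Star R (φ f) c → Σ F λ g → Valid g × c ≡ φ g × Star S (ψ f) (ψ g)
  simulate⋆ f valid ε = f , valid , refl , ε
  simulate⋆ f valid (r ◅ rs) with simulate f valid r
  ... | g , valid-g , refl , s with simulate⋆ g valid-g rs
  ...   | h , valid-h , c≡φh , ss = h , valid-h , c≡φh , s ◅ ss

module SimulationIso {n m : ℕ} (G : Graph n) (H : Graph m)
  {F : Set} (Valid : F → Set) (φ : F → Config n) (ψ : F → Config m)
  (f₀ : F) (valid₀ : Valid f₀)
  (G⇒H : ∀ f → Valid f → ∀ {c} → Step G (φ f) c → Σ F λ g → Valid g × c ≡ φ g × Step H (ψ f) (ψ g))
  (H⇒G : ∀ f → Valid f → ∀ {c} → Step H (ψ f) c → Σ F λ g → Valid g × c ≡ ψ g × Step G (φ f) (φ g))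
  (φ⇒ψ : ∀ f g → Valid f → Valid g → φ f ≡ φ g → ψ f ≡ ψ g)
  (ψ⇒φ : ∀ f g → Valid f → Valid g → ψ f ≡ ψ g → φ f ≡ φ g) where

  represent-G : ∀ {c} → Reach G (φ f₀) c → Σ F λ f → Valid f × c ≡ φ f × Reach H (ψ f₀) (ψ f)
  represent-G = simulate⋆ Valid (Step G) (Step H) φ ψ G⇒H f₀ valid₀

  represent-H : ∀ {c} → Reach H (ψ f₀) c → Σ F λ f → Valid f × c ≡ ψ f × Reach G (φ f₀) (φ f)
  represent-H = simulate⋆ Valid (Step H) (Step G) ψ φ H⇒G f₀ valid₀

  to : CFG G (φ f₀) → CFG H (ψ f₀)
  to (_ , r) = ψ (proj₁ (represent-G r)) , proj₂ (proj₂ (proj₂ (represent-G r)))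

  from : CFG H (ψ f₀) → CFG G (φ f₀)
  from (_ , r) = φ (proj₁ (represent-H r)) , proj₂ (proj₂ (proj₂ (represent-H r)))

  from∘to : ∀ x → proj₁ (from (to x)) ≡ proj₁ x
  from∘to (c , r) with represent-G r
  ... | f , valid-f , c≡φf , s with represent-H s
  ...   | g , valid-g , ψf≡ψg , _ = trans (ψ⇒φ g f valid-g valid-f (sym ψf≡ψg)) (sym c≡φf)

  to∘from : ∀ y → proj₁ (to (from y)) ≡ proj₁ y
  to∘from (c , r) with represent-H r
  ... | f , valid-f , c≡ψf , s with represent-G s
  ...   | g , valid-g , φf≡φg , _ = trans (φ⇒ψ g f valid-g valid-f (sym φf≡φg)) (sym c≡ψf)

  to-mono : ∀ x y → Reach G (proj₁ x) (proj₁ y) → Reach H (proj₁ (to x)) (proj₁ (to y))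
  to-mono (c , r) (c′ , r′) path with represent-G r | represent-G r′
  ... | f , valid-f , refl , _ | f′ , valid-f′ , refl , _ with simulate⋆ Valid (Step G) (Step H) φ ψ G⇒H f valid-f path
  ...   | g , valid-g , φf′≡φg , steps = subst (Reach H (ψ f)) (φ⇒ψ g f′ valid-g valid-f′ (sym φf′≡φg)) steps

  from-mono : ∀ x y → Reach H (proj₁ x) (proj₁ y) → Reach G (proj₁ (from x)) (proj₁ (from y))
  from-mono (c , r) (c′ , r′) path with represent-H r | represent-H r′
  ... | f , valid-f , refl , _ | f′ , valid-f′ , refl , _ with simulate⋆ Valid (Step H) (Step G) ψ φ H⇒G f valid-f path
  ...   | g , valid-g , ψf′≡ψg , steps = subst (Reach G (φ f)) (ψ⇒φ g f′ valid-g valid-f′ (sym ψf′≡ψg)) steps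

  iso : CFGIso G (φ f₀) H (ψ f₀)
  iso = record { to = to ; from = from ; from∘to = from∘to ; to∘from = to∘from ; to-mono = to-mono ; from-mono = from-mono }

module Sandpile {n : ℕ} (G : Graph n) (O : Config n) (acyclic : Acyclic G) where
  open AcyclicGame G O acyclic public
  open Height G acyclic using (height; height-decreases)

  -- The slot (v , k) stands for the (k + 1)-st firing of v; H has one vertex per
  -- slot plus a sink.
  Slot : Set
  Slot = Fin n × Fin N

  live : Fin n → ℕ
  live v = 𝟙 (0 <? d v)

  -- Scales grow by the factor M along every edge of G, so M exceeds all back-flow.
  M : ℕ
  M = suc (N * ∑ d)

  scale : Fin n → ℕ
  scale v = M ^ height v

  -- The weight linking consecutive slots of v; it exceeds every possible supply.
  chainWeight : Fin n → ℕ
  chainWeight v = scale v * suc (total-chips + N * total-edges)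

  signal : Slot → Slot → ℕ
  signal (a , _) (b , _) = live b * (scale b * G a b)

  chain : Slot → Slot → ℕ
  chain (a , i) (b , j) = 𝟙 (a ≟ b) * (live b * (𝟙 (suc (toℕ i) ≟ℕ toℕ j) * chainWeight b))

  weight : Slot → Slot → ℕ
  weight x y = signal x y + signal y x + chain x y + chain y x

  weight-sym : ∀ x y → weight y x ≡ weight x y
  weight-sym x y = swap (signal x y) (signal y x) (chain x y) (chain y x)
    where
    swap : ∀ a b c e → b + a + e + c ≡ a + b + c + e
    swap = solve-∀

  slot : Fin (n * N) → Slot
  slot = remQuot {n} N

  vertex : Fin (n * N) → Fin n
  vertex i = proj₁ (slot i)

  index : Fin (n * N) → ℕ
  index i = toℕ (proj₂ (slot i))

  slot-injective : ∀ {i j} → vertex j ≡ vertex i → index j ≡ index i → j ≡ i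
  slot-injective {i} {j} same-vertex same-index =
    trans (sym (combine-remQuot {n} N j)) (trans (cong (uncurry combine) same-slot) (combine-remQuot {n} N i))
    where
    same-slot : slot j ≡ slot i
    same-slot = cong₂ _,_ same-vertex (toℕ-injective same-index)

  slot-of : ∀ v {k} → k < N → Σ (Fin (n * N)) λ i → vertex i ≡ v × index i ≡ k
  slot-of v k<N = combine v (fromℕ< k<N)
                , cong proj₁ (remQuot-combine v (fromℕ< k<N))
                , trans (cong (toℕ ∘ proj₂) (remQuot-combine v (fromℕ< k<N))) (toℕ-fromℕ< k<N)

  m : ℕ
  m = suc (n * N)

  -- The edges to the sink: at least one, so no slot is a sink, and sized so that
  -- slot-identity below holds.
  toSink : Slot → ℕ
  toSink (v , k) = suc (live v * (scale v * (suc (toℕ k) * d v + total-chips)))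

  -- The initial chips of a slot, tuned so that slot-identity below holds.
  initial : Slot → ℕ
  initial X@(v , k) = live v * (scale v * total-chips + 1
                                + ∑ (λ j → signal (slot j) X + signal X (slot j) + chain X (slot j))
                                + scale v * lookup O v)

  -- The sandpile graph: vertex 0 is the sink, vertex suc i is slot i.
  H : Graph m
  H zero    _       = 0
  H (suc i) zero    = toSink (slot i)
  H (suc i) (suc j) = weight (slot i) (slot j)

  initial-chips : Fin m → ℕ
  initial-chips zero    = 0
  initial-chips (suc i) = initial (slot i)

  P : Config m
  P = tabulate initial-chips

  H-sink : IsSink H zero
  H-sink _ _ = refl

  H-non-sink : ∀ i → ¬ IsSink H (suc i)
  H-non-sink i sink with sink zero (λ ())
  ... | ()

  H-is-ASM : IsASMGraph H
  H-is-ASM = (λ u v → to-sink u ◅◅ from-sink v) , (zero , H-sink , unique-sink) , symmetric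
    where
    to-sink : ∀ u → Star (λ a b → Adj H a b ⊎ Adj H b a) u zero
    to-sink zero    = ε
    to-sink (suc i) = inj₁ (s≤s z≤n) ◅ ε
    from-sink : ∀ u → Star (λ a b → Adj H a b ⊎ Adj H b a) zero u
    from-sink zero    = ε
    from-sink (suc i) = inj₂ (s≤s z≤n) ◅ ε
    unique-sink : ∀ v → IsSink H v → v ≡ zero
    unique-sink zero    _    = refl
    unique-sink (suc i) sink = ⊥-elim (H-non-sink i sink)
    symmetric : SymmetricOffSink H
    symmetric zero    _       _ ¬sink _     = ⊥-elim (¬sink H-sink)
    symmetric (suc i) zero    _ _     ¬sink = ⊥-elim (¬sink H-sink)
    symmetric (suc i) (suc j) _ _     _     = weight-sym (slot j) (slot i)

  live-1 : ∀ {v} → 0 < d v → live v ≡ 1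
  live-1 {v} = 𝟙-yes (0 <? d v)

  live-0 : ∀ {v} → d v ≡ 0 → live v ≡ 0
  live-0 {v} dead = 𝟙-no (0 <? d v) (λ pos → <-irrefl (sym dead) pos)

  -- A firing vector f of G is mirrored in H by firing slot (w , k) once iff k < f w.
  fired : (Fin n → ℕ) → Slot → ℕ
  fired f (w , k) = 𝟙 (toℕ k <? f w)

  live-*≤ : ∀ v t → live v * t ≤ t
  live-*≤ v = 𝟙-*≤ (0 <? d v)

  fired-*≤ : ∀ f X t → fired f X * t ≤ t
  fired-*≤ f (w , k) = 𝟙-*≤ (toℕ k <? f w)

  degree : Slot → ℕ
  degree X = toSink X + ∑ (λ j → weight X (slot j))

  received : (Fin n → ℕ) → Slot → ℕ
  received f X = ∑ (λ j → fired f (slot j) * weight (slot j) X)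

  fromPredecessors backflow chainBelow chainAbove : (Fin n → ℕ) → Slot → ℕ
  fromPredecessors f X = ∑ (λ j → fired f (slot j) * signal (slot j) X)
  backflow         f X = ∑ (λ j → fired f (slot j) * signal X (slot j))
  chainBelow       f X = ∑ (λ j → fired f (slot j) * chain (slot j) X)
  chainAbove       f X = ∑ (λ j → fired f (slot j) * chain X (slot j))

  chainTotal : Slot → ℕ
  chainTotal X = ∑ (λ j → chain (slot j) X)

  received-parts : ∀ f X → received f X ≡ fromPredecessors f X + backflow f X + chainBelow f X + chainAbove f X
  received-parts f X =
    trans (∑-cong λ j → distrib (fired f (slot j)) (signal (slot j) X) (signal X (slot j)) (chain (slot j) X) (chain X (slot j)))
    (∑-+₄ (λ j → fired f (slot j) * signal (slot j) X) (λ j → fired f (slot j) * signal X (slot j))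
          (λ j → fired f (slot j) * chain (slot j) X) (λ j → fired f (slot j) * chain X (slot j)))
    where
    distrib : ∀ s a b c e → s * (a + b + c + e) ≡ s * a + s * b + s * c + s * e
    distrib = solve-∀

  fromPredecessors-live : ∀ f → (∀ w → f w ≤ N) → ∀ v k → 0 < d v → fromPredecessors f (v , k) ≡ scale v * inflow f v
  fromPredecessors-live f f≤N v k live-v = begin
    fromPredecessors f (v , k)
      ≡⟨ ∑-remQuot n N (λ y → fired f y * signal y (v , k)) ⟩
    ∑ (λ w → ∑ {N} (λ i → 𝟙 (toℕ i <? f w) * (live v * (scale v * G w v))))
      ≡⟨ ∑-cong (λ w → ∑-*ʳ {N} (λ i → 𝟙 (toℕ i <? f w)) _) ⟩
    ∑ (λ w → ∑ {N} (λ i → 𝟙 (toℕ i <? f w)) * (live v * (scale v * G w v)))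
      ≡⟨ ∑-cong (λ w → cong₂ _*_ (∑-count-below N (f w) (f≤N w)) (cong (_* (scale v * G w v)) (live-1 live-v))) ⟩
    ∑ (λ w → f w * (1 * (scale v * G w v)))
      ≡⟨ ∑-cong (λ w → rearrange (f w) (scale v) (G w v)) ⟩
    ∑ (λ w → scale v * (f w * G w v))
      ≡⟨ ∑-*ˡ (scale v) (λ w → f w * G w v) ⟩
    scale v * inflow f v ∎
    where
    open ≡-Reasoning
    rearrange : ∀ x a g → x * (1 * (a * g)) ≡ a * (x * g)
    rearrange = solve-∀

  scale-drop : ∀ v u → M * (scale u * G v u) ≤ scale v * G v u
  scale-drop v u with 0 <? G v u
  ... | yes vu = subst (_≤ scale v * G v u) (*-assoc M (scale u) (G v u))
                   (*-monoˡ-≤ (G v u) (^-monoʳ-≤ M {suc (height u)} {height v} (height-decreases vu)))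
  ... | no ¬vu rewrite n≤0⇒n≡0 (≮⇒≥ ¬vu) | *-zeroʳ (scale u) | *-zeroʳ M = z≤n

  successors-small : ∀ v → N * ∑ (λ u → scale u * G v u) < scale v
  successors-small v = *-cancelˡ-< M _ _ (begin-strict
    M * (N * S)          ≡⟨ exchange M N S ⟩
    N * (M * S)          ≤⟨ *-monoʳ-≤ N M*S≤ ⟩
    N * (scale v * d v)  ≤⟨ *-monoʳ-≤ N (*-monoʳ-≤ (scale v) (term≤∑ d v)) ⟩
    N * (scale v * ∑ d)  ≡⟨ regroup N (scale v) (∑ d) ⟩
    (N * ∑ d) * scale v  <⟨ *-monoˡ-< (scale v) {{>-nonZero (m^n>0 M (height v))}} (n<1+n (N * ∑ d)) ⟩
    M * scale v          ∎)
    where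
    open ≤-Reasoning
    S = ∑ (λ u → scale u * G v u)
    M*S≤ : M * S ≤ scale v * d v
    M*S≤ = begin
      M * S                          ≡⟨ ∑-*ˡ M (λ u → scale u * G v u) ⟨
      ∑ (λ u → M * (scale u * G v u)) ≤⟨ ∑-mono-≤ (scale-drop v) ⟩
      ∑ (λ u → scale v * G v u)       ≡⟨ ∑-*ˡ (scale v) (G v) ⟩
      scale v * d v                   ∎
    exchange : ∀ a b c → a * (b * c) ≡ b * (a * c)
    exchange = solve-∀
    regroup : ∀ a b c → a * (b * c) ≡ (a * c) * b
    regroup = solve-∀

  backflow-small : ∀ f v k → backflow f (v , k) < scale v
  backflow-small f v k = ≤-<-trans (begin
    backflow f (v , k)                           ≤⟨ ∑-mono-≤ (λ j → fired-*≤ f (slot j) (signal (v , k) (slot j))) ⟩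
    ∑ (λ j → signal (v , k) (slot j))             ≡⟨ ∑-remQuot n N (signal (v , k)) ⟩
    ∑ (λ u → ∑ {N} (λ _ → live u * (scale u * G v u))) ≡⟨ ∑-cong (λ u → ∑-const {N} (live u * (scale u * G v u))) ⟩
    ∑ (λ u → N * (live u * (scale u * G v u)))    ≤⟨ ∑-mono-≤ (λ u → *-monoʳ-≤ N (live-*≤ u _)) ⟩
    ∑ (λ u → N * (scale u * G v u))               ≡⟨ ∑-*ˡ N (λ u → scale u * G v u) ⟩
    N * ∑ (λ u → scale u * G v u)                 ∎) (successors-small v)
    where open ≤-Reasoning

  chain-shape : ∀ a i b j → chain (a , i) (b , j) ≡ 0 ⊎ (a ≡ b × suc (toℕ i) ≡ toℕ j)
  chain-shape a i b j with toSum (a ≟ b)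
  ... | inj₂ a≢b rewrite 𝟙-no (a ≟ b) a≢b = inj₁ refl
  ... | inj₁ refl with toSum (suc (toℕ i) ≟ℕ toℕ j)
  ...   | inj₁ next = inj₂ (refl , next)
  ...   | inj₂ ¬next rewrite 𝟙-no (suc (toℕ i) ≟ℕ toℕ j) ¬next | *-zeroʳ (live a) = inj₁ (*-zeroʳ (𝟙 (a ≟ a)))

  fired-yes : ∀ f w {i} → toℕ i < f w → fired f (w , i) ≡ 1
  fired-yes f w {i} = 𝟙-yes (toℕ i <? f w)

  fired-no : ∀ f w {i} → f w ≤ toℕ i → fired f (w , i) ≡ 0
  fired-no f w {i} le = 𝟙-no (toℕ i <? f w) (≤⇒≯ le)

  chainBelow-full : ∀ f v k → toℕ k ≤ f v → chainBelow f (v , k) ≡ chainTotal (v , k)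
  chainBelow-full f v k k≤fv = ∑-cong λ j → term (slot j)
    where
    term : ∀ y → fired f y * chain y (v , k) ≡ chain y (v , k)
    term (a , i) with chain-shape a i v k
    ... | inj₁ none rewrite none = *-zeroʳ (fired f (a , i))
    ... | inj₂ (refl , next) rewrite fired-yes f a {i} (≤-trans (≤-reflexive next) k≤fv) = +-identityʳ _

  chainBelow-empty : ∀ f v k → f v < toℕ k → chainBelow f (v , k) ≡ 0
  chainBelow-empty f v k fv<k = ∑-zero λ j → term (slot j)
    where
    term : ∀ y → fired f y * chain y (v , k) ≡ 0
    term (a , i) with chain-shape a i v k
    ... | inj₁ none rewrite none = *-zeroʳ (fired f (a , i))
    ... | inj₂ (refl , next) rewrite fired-no f a {i} (≤-pred (≤-trans fv<k (≤-reflexive (sym next)))) = refl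

  chainAbove-empty : ∀ f v k → f v ≤ toℕ k → chainAbove f (v , k) ≡ 0
  chainAbove-empty f v k fv≤k = ∑-zero λ j → term (slot j)
    where
    term : ∀ y → fired f y * chain (v , k) y ≡ 0
    term (a , i) with chain-shape v k a i
    ... | inj₁ none rewrite none = *-zeroʳ (fired f (a , i))
    ... | inj₂ (refl , next) rewrite fired-no f v {i} (≤-trans fv≤k (≤-trans (n≤1+n _) (≤-reflexive next))) = refl

  chainTotal-large : ∀ v k → 0 < d v → 1 ≤ toℕ k → chainWeight v ≤ chainTotal (v , k)
  chainTotal-large v k live-v k≥1 =
    subst (_≤ chainTotal (v , k)) link-weight
      (subst (λ y → chain y (v , k) ≤ chainTotal (v , k)) (remQuot-combine v k′)
        (term≤∑ (λ j → chain (slot j) (v , k)) (combine v k′)))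
    where
    k-1<N : pred (toℕ k) < N
    k-1<N = ≤-<-trans pred[n]≤n (toℕ<n k)
    k′ : Fin N
    k′ = fromℕ< k-1<N
    next : suc (toℕ k′) ≡ toℕ k
    next = trans (cong suc (toℕ-fromℕ< k-1<N)) (suc-pred (toℕ k) {{>-nonZero k≥1}})
    link-weight : chain (v , k′) (v , k) ≡ chainWeight v
    link-weight rewrite 𝟙-yes (v ≟ v) refl | live-1 live-v | 𝟙-yes (suc (toℕ k′) ≟ℕ toℕ k) next =
      trans (+-identityʳ _) (trans (+-identityʳ _) (+-identityʳ _))

  slot-identity : ∀ v k → 0 < d v →
    initial (v , k) + chainTotal (v , k) + scale v * (suc (toℕ k) * d v) ≡ degree (v , k) + scale v * lookup O v
  slot-identity v k live-v = begin
    initial X + e + A * t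
      ≡⟨ cong (λ l → l * (A * o + 1 + ∑ (λ j → signal (slot j) X + signal X (slot j) + chain X (slot j)) + A * om) + e + A * t) (live-1 live-v) ⟩
    1 * (A * o + 1 + ∑ (λ j → signal (slot j) X + signal X (slot j) + chain X (slot j)) + A * om) + e + A * t
      ≡⟨ cong (λ s → 1 * (A * o + 1 + s + A * om) + e + A * t) split-initial ⟩
    1 * (A * o + 1 + (a + b + c) + A * om) + e + A * t
      ≡⟨ regroup A o om t a b c e ⟩
    suc (1 * (A * (t + o))) + (b + a + c + e) + A * om
      ≡⟨ cong₂ (λ l s → suc (l * (A * (t + o))) + s + A * om) (sym (live-1 live-v)) (sym split-degree) ⟩
    degree X + A * om ∎
    where
    open ≡-Reasoning
    X = (v , k)
    A = scale v
    t = suc (toℕ k) * d v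
    o = total-chips
    om = lookup O v
    a = ∑ (λ j → signal (slot j) X)
    b = ∑ (λ j → signal X (slot j))
    c = ∑ (λ j → chain X (slot j))
    e = chainTotal X
    split-initial : ∑ (λ j → signal (slot j) X + signal X (slot j) + chain X (slot j)) ≡ a + b + c
    split-initial = trans (∑-+ (λ j → signal (slot j) X + signal X (slot j)) (λ j → chain X (slot j)))
                          (cong (_+ c) (∑-+ (λ j → signal (slot j) X) (λ j → signal X (slot j))))
    split-degree : ∑ (λ j → weight X (slot j)) ≡ b + a + c + e
    split-degree = ∑-+₄ (λ j → signal X (slot j)) (λ j → signal (slot j) X) (λ j → chain X (slot j)) (λ j → chain (slot j) X)
    regroup : ∀ A o om t a b c e → 1 * (A * o + 1 + (a + b + c) + A * om) + e + A * t ≡ suc (1 * (A * (t + o))) + (b + a + c + e) + A * om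
    regroup = solve-∀

  slot-balance : ∀ f → (∀ w → f w ≤ N) → ∀ v k → 0 < d v →
    initial (v , k) + received f (v , k) + chainTotal (v , k) + scale v * (suc (toℕ k) * d v)
      ≡ degree (v , k) + scale v * supply f v + backflow f (v , k) + chainBelow f (v , k) + chainAbove f (v , k)
  slot-balance f f≤N v k live-v = begin
    initial X + received f X + chainTotal X + A * t
      ≡⟨ regroup (initial X) (received f X) (chainTotal X) (A * t) ⟩
    (initial X + chainTotal X + A * t) + received f X
      ≡⟨ cong₂ _+_ (slot-identity v k live-v) (received-parts f X) ⟩
    (degree X + A * lookup O v) + (fromPredecessors f X + backflow f X + chainBelow f X + chainAbove f X)
      ≡⟨ cong (λ s → (degree X + A * lookup O v) + (s + backflow f X + chainBelow f X + chainAbove f X)) (fromPredecessors-live f f≤N v k live-v) ⟩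
    (degree X + A * lookup O v) + (A * inflow f v + backflow f X + chainBelow f X + chainAbove f X)
      ≡⟨ collect (degree X) A (lookup O v) (inflow f v) (backflow f X) (chainBelow f X) (chainAbove f X) ⟩
    degree X + A * supply f v + backflow f X + chainBelow f X + chainAbove f X ∎
    where
    open ≡-Reasoning
    X = (v , k)
    A = scale v
    t = suc (toℕ k) * d v
    regroup : ∀ p r c T → p + r + c + T ≡ (p + c + T) + r
    regroup = solve-∀
    collect : ∀ D A o i b l u → (D + A * o) + (A * i + b + l + u) ≡ D + A * (o + i) + b + l + u
    collect = solve-∀

  supply-capped : ∀ f → (∀ w → f w ≤ N) → ∀ v → scale v * suc (supply f v) ≤ chainWeight v
  supply-capped f f≤N v = *-monoʳ-≤ (scale v)
    (s≤s (+-mono-≤ (term≤∑ (lookup O) v) (inflow-bound f N v (λ w _ → f≤N w))))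

  loaded-balance : ∀ f → (∀ w → f w ≤ N) → ∀ v k → 0 < d v → toℕ k ≤ f v →
    initial (v , k) + received f (v , k) + scale v * (suc (toℕ k) * d v)
      ≡ degree (v , k) + scale v * supply f v + backflow f (v , k) + chainAbove f (v , k)
  loaded-balance f f≤N v k live-v k≤fv = +-cancelʳ-≡ (chainTotal X) _ _ (begin
    initial X + received f X + T + chainTotal X        ≡⟨ swap (initial X + received f X) T (chainTotal X) ⟩
    initial X + received f X + chainTotal X + T        ≡⟨ slot-balance f f≤N v k live-v ⟩
    D + chainBelow f X + chainAbove f X                ≡⟨ cong (λ b → D + b + chainAbove f X) (chainBelow-full f v k k≤fv) ⟩
    D + chainTotal X + chainAbove f X                  ≡⟨ swap D (chainTotal X) (chainAbove f X) ⟩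
    D + chainAbove f X + chainTotal X                  ∎)
    where
    open ≡-Reasoning
    X = (v , k)
    T = scale v * (suc (toℕ k) * d v)
    D = degree X + scale v * supply f v + backflow f X
    swap : ∀ a b c → a + b + c ≡ a + c + b
    swap = solve-∀

  slot-loaded : ∀ f → (∀ w → f w ≤ N) → ∀ v k → 0 < d v → toℕ k ≤ f v → suc (toℕ k) * d v ≤ supply f v →
    degree (v , k) ≤ initial (v , k) + received f (v , k)
  slot-loaded f f≤N v k live-v k≤fv enough = +-cancelʳ-≤ T _ _ (begin
    degree X + T                                                            ≤⟨ +-monoʳ-≤ (degree X) (*-monoʳ-≤ (scale v) enough) ⟩
    degree X + scale v * supply f v                                         ≤⟨ m≤m+n _ (backflow f X) ⟩
    degree X + scale v * supply f v + backflow f X                          ≤⟨ m≤m+n _ (chainAbove f X) ⟩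
    degree X + scale v * supply f v + backflow f X + chainAbove f X         ≡⟨ loaded-balance f f≤N v k live-v k≤fv ⟨
    initial X + received f X + T                                            ∎)
    where
    open ≤-Reasoning
    X = (v , k)
    T = scale v * (suc (toℕ k) * d v)

  -- Conversely, if slot (v , f v) holds its degree then v can fire once more in G;
  -- the back-flow is too small to make up a missing chip of v.
  next-slot-ready : ∀ f → (∀ w → f w ≤ N) → ∀ v k → 0 < d v → toℕ k ≡ f v →
    degree (v , k) ≤ initial (v , k) + received f (v , k) → CanFire f v
  next-slot-ready f f≤N v k live-v k≡fv loaded =
    subst (λ x → suc x * d v ≤ supply f v) k≡fv (≤-pred (*-cancelˡ-< (scale v) _ _ scaled))
    where
    open ≤-Reasoning
    X = (v , k)
    T = scale v * (suc (toℕ k) * d v)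
    balance : degree X + T ≤ degree X + (scale v * supply f v + backflow f X)
    balance = begin
      degree X + T                                                      ≤⟨ +-monoˡ-≤ T loaded ⟩
      initial X + received f X + T                                      ≡⟨ loaded-balance f f≤N v k live-v (≤-reflexive k≡fv) ⟩
      degree X + scale v * supply f v + backflow f X + chainAbove f X   ≡⟨ cong (degree X + scale v * supply f v + backflow f X +_)
                                                                            (chainAbove-empty f v k (≤-reflexive (sym k≡fv))) ⟩
      degree X + scale v * supply f v + backflow f X + 0                ≡⟨ +-identityʳ _ ⟩
      degree X + scale v * supply f v + backflow f X                    ≡⟨ +-assoc (degree X) _ _ ⟩
      degree X + (scale v * supply f v + backflow f X)                  ∎
    scaled : T < scale v * suc (supply f v)
    scaled = begin-strict
      T                                        ≤⟨ +-cancelˡ-≤ (degree X) _ _ balance ⟩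
      scale v * supply f v + backflow f X      <⟨ +-monoʳ-< (scale v * supply f v) (backflow-small f v k) ⟩
      scale v * supply f v + scale v           ≡⟨ +-comm (scale v * supply f v) (scale v) ⟩
      scale v + scale v * supply f v           ≡⟨ *-suc (scale v) (supply f v) ⟨
      scale v * suc (supply f v)               ∎

  -- A slot further up the chain than the next one lacks the chain weight.
  far-slot-stuck : ∀ f → (∀ w → f w ≤ N) → ∀ v k → 0 < d v → f v < toℕ k →
    initial (v , k) + received f (v , k) < degree (v , k)
  far-slot-stuck f f≤N v k live-v fv<k = +-cancelʳ-< (chainTotal X + T) _ _ (begin-strict
    initial X + received f X + (chainTotal X + T)
      ≡⟨ +-assoc (initial X + received f X) _ _ ⟨
    initial X + received f X + chainTotal X + T
      ≡⟨ slot-balance f f≤N v k live-v ⟩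
    degree X + scale v * supply f v + backflow f X + chainBelow f X + chainAbove f X
      ≡⟨ cong₂ (λ b a → degree X + scale v * supply f v + backflow f X + b + a)
               (chainBelow-empty f v k fv<k) (chainAbove-empty f v k (<⇒≤ fv<k)) ⟩
    degree X + scale v * supply f v + backflow f X + 0 + 0
      ≡⟨ regroup (degree X) (scale v * supply f v) (backflow f X) ⟩
    degree X + (scale v * supply f v + backflow f X)
      <⟨ +-monoʳ-< (degree X) (+-monoʳ-< (scale v * supply f v) (backflow-small f v k)) ⟩
    degree X + (scale v * supply f v + scale v)
      ≡⟨ cong (degree X +_) (trans (+-comm _ (scale v)) (sym (*-suc (scale v) (supply f v)))) ⟩
    degree X + scale v * suc (supply f v)
      ≤⟨ +-monoʳ-≤ (degree X) (supply-capped f f≤N v) ⟩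
    degree X + chainWeight v
      ≤⟨ +-monoʳ-≤ (degree X) (chainTotal-large v k live-v (≤-trans (s≤s z≤n) fv<k)) ⟩
    degree X + chainTotal X
      ≤⟨ +-monoʳ-≤ (degree X) (m≤m+n (chainTotal X) T) ⟩
    degree X + (chainTotal X + T) ∎)
    where
    open ≤-Reasoning
    X = (v , k)
    T = scale v * (suc (toℕ k) * d v)
    regroup : ∀ a b c → a + b + c + 0 + 0 ≡ a + (b + c)
    regroup = solve-∀

  -- A slot receives less than its degree, and initially holds less than its
  -- degree plus its sink edges: a fired slot cannot fire a second time.
  received-small : ∀ f X → received f X + toSink X ≤ degree X
  received-small f X = ≤-trans (+-monoˡ-≤ (toSink X) (∑-mono-≤ term)) (≤-reflexive (+-comm _ (toSink X)))
    where
    term : ∀ j → fired f (slot j) * weight (slot j) X ≤ weight X (slot j)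
    term j = ≤-trans (fired-*≤ f (slot j) _) (≤-reflexive (weight-sym X (slot j)))

  initial-small : ∀ v k → 0 < d v → initial (v , k) < degree (v , k) + toSink (v , k)
  initial-small v k live-v = ≤-<-trans
    (≤-trans (m≤m+n _ (chainTotal X)) (≤-trans (m≤m+n _ (scale v * (suc (toℕ k) * d v))) (≤-reflexive (slot-identity v k live-v))))
    (+-monoʳ-< (degree X) own-chips<toSink)
    where
    X = (v , k)
    own-chips<toSink : scale v * lookup O v < toSink X
    own-chips<toSink rewrite live-1 live-v | *-identityˡ (scale v * (suc (toℕ k) * d v + total-chips)) =
      s≤s (*-monoʳ-≤ (scale v) (≤-trans (term≤∑ (lookup O) v) (m≤n+m total-chips _)))

  dead-weight : ∀ v k → d v ≡ 0 → ∀ y → weight (v , k) y ≡ 0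
  dead-weight v k dead (a , i) = cong₂ _+_ (cong₂ _+_ (cong₂ _+_ out in′) chain-out) chain-in
    where
    out : signal (v , k) (a , i) ≡ 0
    out rewrite ∑≡0⇒term≡0 (G v) dead a | *-zeroʳ (scale a) = *-zeroʳ (live a)
    in′ : signal (a , i) (v , k) ≡ 0
    in′ rewrite live-0 dead = refl
    chain-out : chain (v , k) (a , i) ≡ 0
    chain-out with chain-shape v k a i
    ... | inj₁ none     = none
    ... | inj₂ (refl , _) rewrite live-0 dead = *-zeroʳ (𝟙 (v ≟ v))
    chain-in : chain (a , i) (v , k) ≡ 0
    chain-in rewrite live-0 dead = *-zeroʳ (𝟙 (a ≟ v))

  dead-slot-stuck : ∀ f v k → d v ≡ 0 → initial (v , k) + received f (v , k) < degree (v , k)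
  dead-slot-stuck f v k dead = subst₂ _<_ (sym (cong₂ _+_ dead-initial dead-received)) (sym dead-degree) (s≤s z≤n)
    where
    dead-initial : initial (v , k) ≡ 0
    dead-initial rewrite live-0 dead = refl
    dead-received : received f (v , k) ≡ 0
    dead-received = ∑-zero λ j → trans (cong (fired f (slot j) *_) (trans (weight-sym (v , k) (slot j)) (dead-weight v k dead (slot j))))
                                      (*-zeroʳ (fired f (slot j)))
    dead-degree : degree (v , k) ≡ 1
    dead-degree = cong₂ _+_ (cong (λ l → suc (l * (scale v * (suc (toℕ k) * d v + total-chips)))) (live-0 dead))
                            (∑-zero (λ j → dead-weight v k dead (slot j)))

  SlotCanFire : (Fin n → ℕ) → Slot → Set
  SlotCanFire f X = suc (fired f X) * degree X ≤ initial X + received f X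

  unfired-slot-fires : ∀ f X → fired f X ≡ 0 → SlotCanFire f X → degree X ≤ initial X + received f X
  unfired-slot-fires f X unfired can rewrite unfired = subst (_≤ initial X + received f X) (+-identityʳ (degree X)) can

  -- Mirrored firing vectors are admissible in H: a fired slot (v , k) had v firable
  -- at least k + 1 times.
  slot-admissible : ∀ f → Valid f → ∀ v k → fired f (v , k) * degree (v , k) ≤ initial (v , k) + received f (v , k)
  slot-admissible f valid v k with toℕ k <? f v
  ... | no k≮fv rewrite fired-no f v (≮⇒≥ k≮fv) = z≤n
  ... | yes k<fv rewrite fired-yes f v k<fv = subst (_≤ initial (v , k) + received f (v , k)) (sym (+-identityʳ (degree (v , k))))
        (slot-loaded f (firings≤N f valid) v k (fired⇒live f valid v (≤-<-trans z≤n k<fv)) (<⇒≤ k<fv)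
          (≤-trans (*-monoˡ-≤ (d v) k<fv) (proj₁ valid v)))

  slot-fires⇒ : ∀ f → Valid f → ∀ v k → SlotCanFire f (v , k) → 0 < d v × toℕ k ≡ f v × CanFire f v
  slot-fires⇒ f valid v k can with live-or-dead v
  ... | inj₂ dead = ⊥-elim (<⇒≱ (dead-slot-stuck f v k dead) (≤-trans (m≤m+n _ _) can))
  ... | inj₁ live-v with <-cmp (toℕ k) (f v)
  ...   | tri< k<fv _ _ = ⊥-elim (<⇒≱ twice-degree (subst (λ x → suc x * degree X ≤ initial X + received f X) (fired-yes f v k<fv) can))
    where
    X = (v , k)
    twice-degree : initial X + received f X < 2 * degree X
    twice-degree = begin-strict
      initial X + received f X                 <⟨ +-monoˡ-< (received f X) (initial-small v k live-v) ⟩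
      degree X + toSink X + received f X       ≡⟨ regroup (degree X) (toSink X) (received f X) ⟩
      degree X + (received f X + toSink X)     ≤⟨ +-monoʳ-≤ (degree X) (received-small f X) ⟩
      degree X + degree X                      ≡⟨ cong (degree X +_) (+-identityʳ (degree X)) ⟨
      2 * degree X                             ∎
      where
      open ≤-Reasoning
      regroup : ∀ a b c → a + b + c ≡ a + (c + b)
      regroup = solve-∀
  ...   | tri> _ _ k>fv = ⊥-elim (<⇒≱ (far-slot-stuck f (firings≤N f valid) v k live-v k>fv)
                                       (unfired-slot-fires f (v , k) (fired-no f v (<⇒≤ k>fv)) can))
  ...   | tri≈ _ k≡fv _ = live-v , k≡fv , next-slot-ready f (firings≤N f valid) v k live-v k≡fv
                                            (unfired-slot-fires f (v , k) (fired-no f v (≤-reflexive (sym k≡fv))) can)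

  slot-fires⇐ : ∀ f → Valid f → ∀ v k → 0 < d v → toℕ k ≡ f v → CanFire f v → SlotCanFire f (v , k)
  slot-fires⇐ f valid v k live-v k≡fv can rewrite fired-no f v {k} (≤-reflexive (sym k≡fv)) =
    subst (_≤ initial (v , k) + received f (v , k)) (sym (+-identityʳ (degree (v , k))))
      (slot-loaded f (firings≤N f valid) v k live-v (≤-reflexive k≡fv)
        (subst (λ x → suc x * d v ≤ supply f v) (sym k≡fv) can))

  module HF = FiringVectors H P

  lift : (Fin n → ℕ) → Fin m → ℕ
  lift f zero    = 0
  lift f (suc j) = fired f (slot j)

  sandpile : (Fin n → ℕ) → Config m
  sandpile f = HF.config (lift f)

  slot-supply : ∀ f i → HF.supply (lift f) (suc i) ≡ initial (slot i) + received f (slot i)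
  slot-supply f i = cong (_+ received f (slot i)) (lookup∘tabulate initial-chips (suc i))

  H-CanFire≡SlotCanFire : ∀ f i → HF.CanFire (lift f) (suc i) ≡ SlotCanFire f (slot i)
  H-CanFire≡SlotCanFire f i = cong (suc (fired f (slot i)) * degree (slot i) ≤_) (slot-supply f i)

  lift-admissible : ∀ f → Valid f → HF.Admissible (lift f)
  lift-admissible f valid zero    = z≤n
  lift-admissible f valid (suc i) =
    subst (fired f (slot i) * degree (slot i) ≤_) (sym (slot-supply f i)) (slot-admissible f valid _ _)

  lift-zero : ∀ y → lift (λ _ → 0) y ≡ 0
  lift-zero zero    = refl
  lift-zero (suc j) = refl

  sandpile-zero : sandpile (λ _ → 0) ≡ P
  sandpile-zero = trans (HF.config-cong lift-zero) HF.config-zero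

  sandpile-cong : ∀ {f g} → (∀ v → f v ≡ g v) → sandpile f ≡ sandpile g
  sandpile-cong {f} {g} f≗g = HF.config-cong {lift f} {lift g} lift-cong
    where
    lift-cong : ∀ y → lift f y ≡ lift g y
    lift-cong zero    = refl
    lift-cong (suc j) = cong (λ x → 𝟙 (index j <? x)) (f≗g (vertex j))

  lift-⊕ : ∀ f i → index i ≡ f (vertex i) → ∀ y → (lift f HF.⊕ suc i) y ≡ lift (f ⊕ vertex i) y
  lift-⊕ f i next zero = refl
  lift-⊕ f i next (suc j) with toSum (j ≟ i)
  ... | inj₁ refl rewrite 𝟙-yes (j ≟ j) refl | fired-no f (vertex j) {proj₂ (slot j)} (≤-reflexive (sym next)) =
        sym (fired-yes (f ⊕ vertex j) (vertex j) (subst (index j <_) (sym (⊕-self f (vertex j))) (s≤s (≤-reflexive next))))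
  ... | inj₂ j≢i rewrite 𝟙-no (j ≟ i) j≢i | +-identityʳ (fired f (slot j)) with toSum (vertex j ≟ vertex i)
  ...   | inj₂ other-vertex = cong (λ x → 𝟙 (index j <? x)) (sym (⊕-other f other-vertex))
  ...   | inj₁ same-vertex = begin
    𝟙 (index j <? f (vertex j))             ≡⟨ cong (λ x → 𝟙 (index j <? f x)) same-vertex ⟩
    𝟙 (index j <? f (vertex i))             ≡⟨ 𝟙-<-suc other-index ⟨
    𝟙 (index j <? suc (f (vertex i)))       ≡⟨ cong (λ x → 𝟙 (index j <? x)) (trans (cong (f ⊕ vertex i) same-vertex) (⊕-self f (vertex i))) ⟨
    𝟙 (index j <? (f ⊕ vertex i) (vertex j)) ∎
    where
    open ≡-Reasoning
    other-index : index j ≢ f (vertex i)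
    other-index same = j≢i (slot-injective same-vertex (trans same (sym next)))

  sandpile-fire : ∀ f → Valid f → ∀ i → index i ≡ f (vertex i) → HF.CanFire (lift f) (suc i) →
                  fire H (sandpile f) (suc i) ≡ sandpile (f ⊕ vertex i)
  sandpile-fire f valid i next can =
    trans (HF.fire-config (lift f) (suc i) (lift-admissible f valid) can) (HF.config-cong (lift-⊕ f i next))

  -- Fired slots end below their initial chips, unfired ones at least at them;
  -- so the sandpile configuration determines the firing vector.
  slot-value : ∀ f → Valid f → ∀ i →
    lookup (sandpile f) (suc i) + fired f (slot i) * degree (slot i) ≡ initial (slot i) + received f (slot i)
  slot-value f valid i = trans (HF.config-balance (lift f) (lift-admissible f valid) (suc i)) (slot-supply f i)

  value-unfired : ∀ f → Valid f → ∀ i → fired f (slot i) ≡ 0 → initial (slot i) ≤ lookup (sandpile f) (suc i)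
  value-unfired f valid i unfired = begin
    initial (slot i)                                             ≤⟨ m≤m+n _ _ ⟩
    initial (slot i) + received f (slot i)                       ≡⟨ slot-value f valid i ⟨
    lookup (sandpile f) (suc i) + fired f (slot i) * degree (slot i) ≡⟨ cong (λ c → lookup (sandpile f) (suc i) + c * degree (slot i)) unfired ⟩
    lookup (sandpile f) (suc i) + 0                              ≡⟨ +-identityʳ _ ⟩
    lookup (sandpile f) (suc i)                                  ∎
    where open ≤-Reasoning

  value-fired : ∀ f → Valid f → ∀ i → fired f (slot i) ≡ 1 → lookup (sandpile f) (suc i) < initial (slot i)
  value-fired f valid i fired-once = +-cancelʳ-< (degree (slot i)) _ _ (begin-strict
    lookup (sandpile f) (suc i) + degree (slot i)                    ≡⟨ cong (lookup (sandpile f) (suc i) +_) (+-identityʳ _) ⟨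
    lookup (sandpile f) (suc i) + 1 * degree (slot i)                ≡⟨ cong (λ c → lookup (sandpile f) (suc i) + c * degree (slot i)) (sym fired-once) ⟩
    lookup (sandpile f) (suc i) + fired f (slot i) * degree (slot i) ≡⟨ slot-value f valid i ⟩
    initial (slot i) + received f (slot i)                           <⟨ +-monoʳ-< (initial (slot i)) received<degree ⟩
    initial (slot i) + degree (slot i)                               ∎)
    where
    open ≤-Reasoning
    received<degree : received f (slot i) < degree (slot i)
    received<degree = <-≤-trans (m<m+n (received f (slot i)) (s≤s z≤n)) (received-small f (slot i))

  fewer-firings-visible : ∀ f g → Valid f → Valid g → ∀ v → f v < g v → sandpile f ≢ sandpile g
  fewer-firings-visible f g valid-f valid-g v fv<gv same with slot-of v (firings<N f valid-f v)
  ... | i , refl , at-fv = <-irrefl refl (begin-strict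
    initial (slot i)              ≤⟨ value-unfired f valid-f i (fired-no f (vertex i) (≤-reflexive (sym at-fv))) ⟩
    lookup (sandpile f) (suc i)   ≡⟨ cong (λ c → lookup c (suc i)) same ⟩
    lookup (sandpile g) (suc i)   <⟨ value-fired g valid-g i (fired-yes g (vertex i) (subst (_< g (vertex i)) (sym at-fv) fv<gv)) ⟩
    initial (slot i)              ∎)
    where open ≤-Reasoning

  sandpile-injective : ∀ f g → Valid f → Valid g → sandpile f ≡ sandpile g → ∀ v → f v ≡ g v
  sandpile-injective f g valid-f valid-g same v with <-cmp (f v) (g v)
  ... | tri< fv<gv _ _ = ⊥-elim (fewer-firings-visible f g valid-f valid-g v fv<gv same)
  ... | tri≈ _ fv≡gv _ = fv≡gv
  ... | tri> _ _ gv<fv = ⊥-elim (fewer-firings-visible g f valid-g valid-f v gv<fv (sym same))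

  G⇒H : ∀ f → Valid f → ∀ {c} → Step G (config f) c →
        Σ (Fin n → ℕ) λ g → Valid g × c ≡ config g × Step H (sandpile f) (sandpile g)
  G⇒H f valid (v , ¬sink , firable , c≡fire) with slot-of v (firings<N f valid v)
  ... | i , refl , next = f ⊕ vertex i , Valid-⊕ f (vertex i) valid live-v can
                        , trans c≡fire (fire-config f (vertex i) (proj₁ valid) can) , H-step
    where
    live-v : 0 < d (vertex i)
    live-v = non-sink⇒live (vertex i) ¬sink
    can : CanFire f (vertex i)
    can = firable⇒CanFire f (proj₁ valid) (vertex i) firable
    H-can : HF.CanFire (lift f) (suc i)
    H-can = subst id (sym (H-CanFire≡SlotCanFire f i)) (slot-fires⇐ f valid (vertex i) (proj₂ (slot i)) live-v next can)
    H-step : Step H (sandpile f) (sandpile (f ⊕ vertex i))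
    H-step = suc i , H-non-sink i , HF.CanFire⇒firable (lift f) (lift-admissible f valid) (suc i) H-can
           , sym (sandpile-fire f valid i next H-can)

  H⇒G : ∀ f → Valid f → ∀ {c} → Step H (sandpile f) c →
        Σ (Fin n → ℕ) λ g → Valid g × c ≡ sandpile g × Step G (config f) (config g)
  H⇒G f valid (zero , ¬sink , _ , _) = ⊥-elim (¬sink H-sink)
  H⇒G f valid {c} (suc i , _ , firable , c≡fire) =
    G-move (slot-fires⇒ f valid (vertex i) (proj₂ (slot i)) (subst id (H-CanFire≡SlotCanFire f i) H-can))
    where
    H-can : HF.CanFire (lift f) (suc i)
    H-can = HF.firable⇒CanFire (lift f) (lift-admissible f valid) (suc i) firable
    G-move : 0 < d (vertex i) × index i ≡ f (vertex i) × CanFire f (vertex i) →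
             Σ (Fin n → ℕ) λ g → Valid g × c ≡ sandpile g × Step G (config f) (config g)
    G-move (live-v , next , can) =
        f ⊕ vertex i , Valid-⊕ f (vertex i) valid live-v can
      , trans c≡fire (sandpile-fire f valid i next H-can)
      , (vertex i , live⇒non-sink (vertex i) live-v , CanFire⇒firable f (proj₁ valid) (vertex i) can
        , sym (fire-config f (vertex i) (proj₁ valid) can))

mainTheorem3 : (n : ℕ) (G : Graph n) (O : Config n) → Acyclic G →
    Σ ℕ λ m → Σ (Graph m) λ H → Σ (Config m) λ P → IsASMGraph H × CFGIso G O H P
mainTheorem3 n G O acyclic = m , H , P , H-is-ASM , subst₂ (λ o p → CFGIso G o H p) config-zero sandpile-zero iso
  where
  open Sandpile G O acyclic
  open SimulationIso G H Valid config sandpile (λ _ → 0) Valid-zero G⇒H H⇒G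
         (λ f g valid-f valid-g same → sandpile-cong (config-injective f g valid-f valid-g same))
         (λ f g valid-f valid-g same → config-cong (sandpile-injective f g valid-f valid-g same))
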